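{- Let $n > 3$ be an integer. Then stit logic does not have the $n$-Craig Interpolation Property $(CIP)_n$; that is, it is not the case that for every set of propositional variables $V$ and all $A, B \in \mathcal{L}^{\{1,\ldots,n\}}_V$ with $\vdash A \to B$ there exists $C \in \mathcal{L}^{Ag(A)\cup Ag(B)}_{|A|\cap|B|}$ with $\vdash A \to C$ and $\vdash C \to B$.
   Context: For a finite set $Ag$ of agent indices and a set $V$ of propositional variables, $\mathcal{L}^{Ag}_V$ is the set of stit formulas given by $A ::= p \mid A \to A \mid \bot \mid \Box A \mid [j]A$ with $p \in V$, $j \in Ag$ (other Boolean connectives defined as usual; $\Diamond A := \neg\Box\neg A$). $\vdash A$ means derivability in the axiom system $\mathbb{S}$ with axioms: all classical propositional tautologies; S5 axioms for $\Box$ and for each $[j]$; $\Box A \to [j]A$; and $(\Diamond[j_1]A_1 \wedge\dots\wedge \Diamond[j_k]A_k) \to \Diamond([j_1]A_1\wedge\dots\wedge[j_k]A_k)$ for pairwise distinct $j_1,\dots,j_k$; rules: modus ponens and necessitation for $\Box$. For a formula $A$, $|A|$ is the set of propositional variables occurring in $A$ and $Ag(A)$ the set of agent indices occurring in $A$. -}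

module Defs where

open import Data.Nat using (ℕ)
open import Data.Fin using (Fin)
open import Data.Bool using (Bool; true; false; not; _∨_)
open import Data.List using (List; []; _∷_; map)
open import Data.List.Relation.Unary.Unique.Propositional using (Unique)
open import Data.Product using (_×_; _,_; proj₁; Σ-syntax)
open import Data.Sum using (_⊎_)
open import Data.Empty using (⊥)
open import Relation.Binary.PropositionalEquality using (_≡_)

infixr 5 _⇒_

data Form (V : Set) (n : ℕ) : Set where
  var  : V → Form V n
  _⇒_  : Form V n → Form V n → Form V n
  ⊥'   : Form V n
  □    : Form V n → Form V n
  [_]  : Fin n → Form V n → Form V n

module _ {V : Set} {n : ℕ} where

  ¬' : Form V n → Form V n
  ¬' A = A ⇒ ⊥'

  ⊤' : Form V n
  ⊤' = ¬' ⊥'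

  _∧'_ : Form V n → Form V n → Form V n
  A ∧' B = ¬' (A ⇒ ¬' B)

  ◇ : Form V n → Form V n
  ◇ A = ¬' (□ (¬' A))

  ⋀ : List (Form V n) → Form V n
  ⋀ []       = ⊤'
  ⋀ (A ∷ As) = A ∧' ⋀ As

  eval : (Form V n → Bool) → Form V n → Bool
  eval v (var p)   = v (var p)
  eval v (A ⇒ B)   = not (eval v A) ∨ eval v B
  eval v ⊥'        = false
  eval v (□ A)     = v (□ A)
  eval v ([ j ] A) = v ([ j ] A)

  -- A is an instance of a classical propositional tautology
  Tautology : Form V n → Set
  Tautology A = (v : Form V n → Bool) → eval v A ≡ true

  data ⊢_ : Form V n → Set where
    taut  : ∀ {A} → Tautology A → ⊢ A
    □K    : ∀ {A B} → ⊢ (□ (A ⇒ B) ⇒ □ A ⇒ □ B)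
    □T    : ∀ {A} → ⊢ (□ A ⇒ A)
    □5    : ∀ {A} → ⊢ (◇ A ⇒ □ (◇ A))
    stitK : ∀ {j A B} → ⊢ ([ j ] (A ⇒ B) ⇒ [ j ] A ⇒ [ j ] B)
    stitT : ∀ {j A} → ⊢ ([ j ] A ⇒ A)
    stit5 : ∀ {j A} → ⊢ (¬' ([ j ] (¬' A)) ⇒ [ j ] (¬' ([ j ] (¬' A))))
    □⇒stit : ∀ {j A} → ⊢ (□ A ⇒ [ j ] A)
    indep : (l : List (Fin n × Form V n)) → Unique (map proj₁ l) →
            ⊢ (⋀ (map (λ { (j , A) → ◇ ([ j ] A) }) l)
               ⇒ ◇ (⋀ (map (λ { (j , A) → [ j ] A }) l)))
    mp    : ∀ {A B} → ⊢ (A ⇒ B) → ⊢ A → ⊢ B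
    nec   : ∀ {A} → ⊢ A → ⊢ (□ A)

  VarIn : V → Form V n → Set
  VarIn p (var q)   = p ≡ q
  VarIn p (A ⇒ B)   = VarIn p A ⊎ VarIn p B
  VarIn p ⊥'        = ⊥
  VarIn p (□ A)     = VarIn p A
  VarIn p ([ j ] A) = VarIn p A

  AgIn : Fin n → Form V n → Set
  AgIn i (var q)   = ⊥
  AgIn i (A ⇒ B)   = AgIn i A ⊎ AgIn i B
  AgIn i ⊥'        = ⊥
  AgIn i (□ A)     = AgIn i A
  AgIn i ([ j ] A) = i ≡ j ⊎ AgIn i A

CIP : ℕ → Set₁
CIP n = (V : Set) (A B : Form V n) → ⊢ (A ⇒ B) →
        Σ[ C ∈ Form V n ]
          ((∀ p → VarIn p C → VarIn p A × VarIn p B) ×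
           (∀ j → AgIn j C → AgIn j A ⊎ AgIn j B) ×
           ⊢ (A ⇒ C) × ⊢ (C ⇒ B))

module Submission where

-- A = ◇[0]p ∧ ◇[1](p → r) entails B = ¬(◇[2]q ∧ ◇[3](q → ¬r)): by independence of agents the four
-- choices could be made jointly, and together they force both r and ¬r. An interpolant may only
-- mention r. Let every agent choose one bit; take p = h₀, r = h₀ xor h₁ in one model and
-- q = h₂, r = h₂ xor h₃ in the other. In both, r takes both values in every choice cell, so an
-- r-formula is true at h iff the same Boolean function of r(h) is true. A holds in the first model
-- and B fails in the second at histories with equal r, so no interpolant exists.

open import Defs
open import Data.Nat using (ℕ; zero; suc; _<_; s≤s; z≤n)
open import Data.Fin as Fin using (Fin; #_; _≟_)
open import Data.Bool using (Bool; true; false; not; _∧_; _∨_; _xor_)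
open import Data.Bool.Properties using (xor-assoc; xor-same; xor-identityʳ; ¬-not; not-¬)
open import Data.Vec using (Vec; []; _∷_; lookup; replicate; _[_]≔_)
open import Data.Vec.Properties using (updateAt-id-local; lookup∘update; lookup∘update′)
open import Data.List using (List; []; _∷_; map; _++_)
open import Data.List.Membership.Propositional using (_∈_)
open import Data.List.Relation.Unary.All as All using (All; []; _∷_)
open import Data.List.Relation.Unary.All.Properties as All using ()
open import Data.List.Relation.Unary.Any using (here; there)
open import Data.List.Relation.Unary.AllPairs using ([]; _∷_)
open import Data.List.Relation.Unary.Unique.Propositional using (Unique)
open import Data.Product using (_×_; _,_; proj₁; proj₂; ∃-syntax; uncurry)
open import Data.Sum using (_⊎_; inj₁; inj₂)
open import Data.Empty using (⊥)
open import Function using (_∘_)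
open import Function.Bundles using (_⇔_; mk⇔; Equivalence)
open import Relation.Binary.Definitions using (DecidableEquality)
open import Relation.Binary.PropositionalEquality
  using (_≡_; _≢_; refl; sym; trans; cong; cong₂; subst; module ≡-Reasoning)
open import Relation.Nullary using (¬_; Dec; no; contradiction)
open import Relation.Nullary.Decidable using (yes; _⊎-dec_; toWitnessFalse)

open Equivalence using (to; from)

⇒ᵇ-intro : ∀ a {b} → (a ≡ true → b ≡ true) → not a ∨ b ≡ true
⇒ᵇ-intro false _ = refl
⇒ᵇ-intro true  f = f refl

⇒ᵇ-elim : ∀ a {b} → not a ∨ b ≡ true → a ≡ true → b ≡ true
⇒ᵇ-elim true e refl = e

∧'ᵇ-true : ∀ a b → not (not a ∨ (not b ∨ false)) ∨ false ≡ true ⇔ (a ≡ true × b ≡ true)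
∧'ᵇ-true true  true  = mk⇔ (λ _ → refl , refl) (λ _ → refl)
∧'ᵇ-true true  false = mk⇔ (λ ()) (λ { (_ , ()) })
∧'ᵇ-true false _     = mk⇔ (λ ()) (λ { (() , _) })

∧-true : ∀ {a b} → a ∧ b ≡ true → a ≡ true × b ≡ true
∧-true {true} e = refl , e

allVec : ∀ {k} → (Vec Bool k → Bool) → Bool
allVec {zero}  f = f []
allVec {suc k} f = allVec (λ v → f (true ∷ v)) ∧ allVec (λ v → f (false ∷ v))

allVec-intro : ∀ {k} (f : Vec Bool k → Bool) → (∀ v → f v ≡ true) → allVec f ≡ true
allVec-intro {zero}  f t = t []
allVec-intro {suc k} f t =
  cong₂ _∧_ (allVec-intro _ (t ∘ (true ∷_))) (allVec-intro _ (t ∘ (false ∷_)))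

allVec-elim : ∀ {k} (f : Vec Bool k → Bool) → allVec f ≡ true → ∀ v → f v ≡ true
allVec-elim f e []          = e
allVec-elim f e (true ∷ v)  = allVec-elim _ (proj₁ (∧-true e)) v
allVec-elim f e (false ∷ v) = allVec-elim _ (proj₂ (∧-true e)) v

allVec-false : ∀ {k} (f : Vec Bool k → Bool) → allVec f ≡ false → ∃[ v ] f v ≡ false
allVec-false {zero} f e = [] , e
allVec-false {suc k} f e with allVec (λ v → f (true ∷ v)) in e₁
... | true  = let v , fv = allVec-false _ e  in false ∷ v , fv
... | false = let v , fv = allVec-false _ e₁ in true ∷ v , fv

allVec-false-at : ∀ {k} (f : Vec Bool k → Bool) v → f v ≡ false → allVec f ≡ false
allVec-false-at f v fv with allVec f in e
... | true  with () ← trans (sym (allVec-elim f e v)) fv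
... | false = refl

allVec-cong : ∀ {k} {f g : Vec Bool k → Bool} → (∀ v → f v ≡ g v) → allVec f ≡ allVec g
allVec-cong {zero}  f≗g = f≗g []
allVec-cong {suc k} f≗g =
  cong₂ _∧_ (allVec-cong (f≗g ∘ (true ∷_))) (allVec-cong (f≗g ∘ (false ∷_)))

allVec-∘-onto : ∀ {k} (φ : Bool → Bool) (ρ : Vec Bool k → Bool) → (∀ x → ∃[ v ] ρ v ≡ x) →
                allVec (φ ∘ ρ) ≡ φ true ∧ φ false
allVec-∘-onto φ ρ onto with φ true in φt | φ false in φf
... | false | _     = let v , ρv = onto true  in allVec-false-at _ v (trans (cong φ ρv) φt)
... | true  | false = let v , ρv = onto false in allVec-false-at _ v (trans (cong φ ρv) φf)
... | true  | true  = allVec-intro _ (φ-true ∘ ρ)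
  where φ-true : ∀ x → φ x ≡ true
        φ-true true  = φt
        φ-true false = φf

[]≔-id-local : ∀ {k} (g : Vec Bool k) j {b} → lookup g j ≡ b → g [ j ]≔ b ≡ g
[]≔-id-local g j e = updateAt-id-local j g (sym e)

xor-onto-cells : ∀ {k} {i l : Fin k} → i ≢ l → ∀ j (h : Vec Bool k) x →
                 ∃[ g ] lookup g j ≡ lookup h j × lookup g i xor lookup g l ≡ x
xor-onto-cells {k} {i} {l} i≢l j h x with j ≟ i
... | yes refl = g , lookup∘update′ i≢l h y , (begin
      lookup g i xor lookup g l
        ≡⟨ cong₂ _xor_ (lookup∘update′ i≢l h y) (lookup∘update l h y) ⟩
      lookup h i xor (lookup h i xor x)  ≡⟨ sym (xor-assoc (lookup h i) _ x) ⟩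
      (lookup h i xor lookup h i) xor x  ≡⟨ cong (_xor x) (xor-same (lookup h i)) ⟩
      x                                  ∎)
  where open ≡-Reasoning
        y : Bool
        y = lookup h i xor x
        g : Vec Bool k
        g = h [ l ]≔ y
... | no j≢i = g , lookup∘update′ j≢i h y , (begin
      lookup g i xor lookup g l
        ≡⟨ cong₂ _xor_ (lookup∘update i h y) (lookup∘update′ (i≢l ∘ sym) h y) ⟩
      (x xor lookup h l) xor lookup h l  ≡⟨ xor-assoc x _ _ ⟩
      x xor (lookup h l xor lookup h l)  ≡⟨ cong (x xor_) (xor-same (lookup h l)) ⟩
      x xor false                        ≡⟨ xor-identityʳ x ⟩
      x                                  ∎)
  where open ≡-Reasoning
        y : Bool
        y = x xor lookup h l
        g : Vec Bool k
        g = h [ i ]≔ y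

xor-onto : ∀ {k} {i l : Fin k} → i ≢ l → ∀ x → ∃[ g ] lookup g i xor lookup g l ≡ x
xor-onto {k} {i} i≢l x = let g , _ , e = xor-onto-cells i≢l i (replicate k false) x in g , e

varIn? : ∀ {V n} → DecidableEquality V → ∀ p (A : Form V n) → Dec (VarIn p A)
varIn? _≟ᵛ_ p (var q)   = p ≟ᵛ q
varIn? _≟ᵛ_ p (A ⇒ B)   = varIn? _≟ᵛ_ p A ⊎-dec varIn? _≟ᵛ_ p B
varIn? _≟ᵛ_ p ⊥'        = no λ ()
varIn? _≟ᵛ_ p (□ A)     = varIn? _≟ᵛ_ p A
varIn? _≟ᵛ_ p ([ j ] A) = varIn? _≟ᵛ_ p A

-- The value of C when all its variables are read as one atom with value x and every modality
-- ranges over both values of that atom.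
rTruth : ∀ {V n} → Form V n → Bool → Bool
rTruth (var _)   x = x
rTruth (A ⇒ B)   x = not (rTruth A x) ∨ rTruth B x
rTruth ⊥'        x = false
rTruth (□ A)     x = rTruth A true ∧ rTruth A false
rTruth ([ j ] A) x = rTruth A true ∧ rTruth A false

module _ {V : Set} {n : ℕ} where

  record _⊩_ (v : Form V n → Bool) (A : Form V n) : Set where
    constructor holds
    field truth : eval v A ≡ true

  open _⊩_ public

  ⇒-intro : ∀ {v A B} → (v ⊩ A → v ⊩ B) → v ⊩ (A ⇒ B)
  ⇒-intro {v} {A} f = holds (⇒ᵇ-intro (eval v A) (truth ∘ f ∘ holds))

  ⇒-elim : ∀ {v A B} → v ⊩ (A ⇒ B) → v ⊩ A → v ⊩ B
  ⇒-elim {v} {A} (holds a⇒b) (holds a) = holds (⇒ᵇ-elim (eval v A) a⇒b a)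

  ⊥'-elim : ∀ {v} {a} {X : Set a} → v ⊩ ⊥' → X
  ⊥'-elim (holds ())

  ⊩-em : ∀ v A → v ⊩ A ⊎ v ⊩ ¬' A
  ⊩-em v A with eval v A in e
  ... | true  = inj₁ (holds e)
  ... | false = inj₂ (⇒-intro λ a → contradiction (trans (sym e) (truth a)) λ ())

  ∧'-⊩ : ∀ {v A B} → v ⊩ (A ∧' B) ⇔ (v ⊩ A × v ⊩ B)
  ∧'-⊩ {v} {A} {B} = mk⇔
    (λ ab → let a , b = to (∧'ᵇ-true (eval v A) (eval v B)) (truth ab) in holds a , holds b)
    (λ (a , b) → holds (from (∧'ᵇ-true (eval v A) (eval v B)) (truth a , truth b)))

  ⋀-⊩ : ∀ {v} As → v ⊩ ⋀ As ⇔ All (v ⊩_) As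
  ⋀-⊩ []       = mk⇔ (λ _ → []) (λ _ → holds refl)
  ⋀-⊩ (A ∷ As) = mk⇔
    (λ aas → let a , as = to ∧'-⊩ aas in a ∷ to (⋀-⊩ As) as)
    (λ { (a ∷ as) → from ∧'-⊩ (a , from (⋀-⊩ As) as) })

  tautology : ∀ {A} → (∀ v → v ⊩ A) → ⊢ A
  tautology t = taut (truth ∘ t)

  ⇒-trans : ∀ {A B C : Form V n} → ⊢ (A ⇒ B) → ⊢ (B ⇒ C) → ⊢ (A ⇒ C)
  ⇒-trans ⊢A⇒B ⊢B⇒C = mp (mp (tautology λ _ →
    ⇒-intro λ a⇒b → ⇒-intro λ b⇒c → ⇒-intro λ a → ⇒-elim b⇒c (⇒-elim a⇒b a)) ⊢A⇒B) ⊢B⇒C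

  ⇒-apply : ∀ {C A B : Form V n} → ⊢ (C ⇒ (A ⇒ B)) → ⊢ (C ⇒ A) → ⊢ (C ⇒ B)
  ⇒-apply ⊢C⇒A⇒B ⊢C⇒A = mp (mp (tautology λ _ →
    ⇒-intro λ c⇒a⇒b → ⇒-intro λ c⇒a → ⇒-intro λ c →
      ⇒-elim (⇒-elim c⇒a⇒b c) (⇒-elim c⇒a c)) ⊢C⇒A⇒B) ⊢C⇒A

  ¬¬-intro : ∀ {A : Form V n} → ⊢ A → ⊢ ¬' (¬' A)
  ¬¬-intro ⊢A = mp (tautology λ _ → ⇒-intro λ a → ⇒-intro λ ¬a → ⇒-elim ¬a a) ⊢A

  ⋀-elim : ∀ As {A : Form V n} → A ∈ As → ⊢ (⋀ As ⇒ A)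
  ⋀-elim As A∈As = tautology λ _ → ⇒-intro λ as → All.lookup (to (⋀-⊩ As) as) A∈As

  ¬⋀-++⇒ : ∀ As Bs → ⊢ ¬' (⋀ (As ++ Bs)) → ⊢ (⋀ As ⇒ ¬' (⋀ Bs))
  ¬⋀-++⇒ As Bs ⊢¬As++Bs = mp (tautology λ _ →
    ⇒-intro λ ¬as++bs → ⇒-intro λ as → ⇒-intro λ bs →
      ⇒-elim ¬as++bs (from (⋀-⊩ (As ++ Bs)) (All.++⁺ (to (⋀-⊩ As) as) (to (⋀-⊩ Bs) bs)))) ⊢¬As++Bs

-- Histories are choice profiles: every agent chooses one bit, independently of the others, and
-- the choice cell of agent j at h is the image of g ↦ g [ j ]≔ lookup h j.
module Semantics {V : Set} {n : ℕ} (val : V → Vec Bool n → Bool) where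

  History : Set
  History = Vec Bool n

  sat : History → Form V n → Bool
  sat h (var p)   = val p h
  sat h (A ⇒ B)   = not (sat h A) ∨ sat h B
  sat h ⊥'        = false
  sat h (□ A)     = allVec (λ g → sat g A)
  sat h ([ j ] A) = allVec (λ g → sat (g [ j ]≔ lookup h j) A)

  _⊨_ : History → Form V n → Set
  h ⊨ A = sat h ⊩ A

  eval-sat : ∀ h A → eval (sat h) A ≡ sat h A
  eval-sat h (var p)   = refl
  eval-sat h (A ⇒ B)   = cong₂ (λ a b → not a ∨ b) (eval-sat h A) (eval-sat h B)
  eval-sat h ⊥'        = refl
  eval-sat h (□ A)     = refl
  eval-sat h ([ j ] A) = refl

  ⊨⇔sat : ∀ {h A} → h ⊨ A ⇔ sat h A ≡ true
  ⊨⇔sat {h} {A} = mk⇔ (trans (sym (eval-sat h A)) ∘ truth) (holds ∘ trans (eval-sat h A))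

  □-intro : ∀ {h A} → (∀ g → g ⊨ A) → h ⊨ □ A
  □-intro k = holds (allVec-intro _ (to ⊨⇔sat ∘ k))

  □-elim : ∀ {h A} → h ⊨ □ A → ∀ g → g ⊨ A
  □-elim □A g = from ⊨⇔sat (allVec-elim _ (truth □A) g)

  stit-intro : ∀ {h j A} → (∀ g → lookup g j ≡ lookup h j → g ⊨ A) → h ⊨ [ j ] A
  stit-intro {h} {j} k =
    holds (allVec-intro _ λ g → to ⊨⇔sat (k _ (lookup∘update j g (lookup h j))))

  stit-elim : ∀ {h j A g} → h ⊨ [ j ] A → lookup g j ≡ lookup h j → g ⊨ A
  stit-elim {A = A} {g} jA e =
    from ⊨⇔sat (subst (λ g′ → sat g′ A ≡ true) ([]≔-id-local g _ e) (allVec-elim _ (truth jA) g))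

  stit-local : ∀ {g h j A} → lookup g j ≡ lookup h j → h ⊨ [ j ] A → g ⊨ [ j ] A
  stit-local {j = j} {A} e jA =
    holds (trans (cong (λ b → allVec (λ g → sat (g [ j ]≔ b) A)) e) (truth jA))

  ◇-intro : ∀ {h A} g → g ⊨ A → h ⊨ ◇ A
  ◇-intro g a = ⇒-intro λ □¬A → ⊥'-elim (⇒-elim (□-elim □¬A g) a)

  ◇-elim : ∀ {h A} → h ⊨ ◇ A → ∃[ g ] g ⊨ A
  ◇-elim {h} {A} ◇A with allVec-false _ (¬-not λ □¬A → ⊥'-elim (⇒-elim ◇A (holds □¬A)))
  ... | g , ¬¬A with ⊩-em (sat g) A
  ...   | inj₁ a  = g , a
  ...   | inj₂ ¬A = contradiction (to ⊨⇔sat ¬A) (not-¬ ¬¬A)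

  stit-update-others : ∀ {j b g} (l : List (Fin n × Form V n)) → All (j ≢_) (map proj₁ l) →
                       All (λ (k , B) → g ⊨ [ k ] B) l → All (λ (k , B) → (g [ j ]≔ b) ⊨ [ k ] B) l
  stit-update-others []            []          []          = []
  stit-update-others {g = g} ((k , B) ∷ l) (j≢k ∷ j∉l) (gB ∷ gl) =
    stit-local (lookup∘update′ (j≢k ∘ sym) g _) gB ∷ stit-update-others l j∉l gl

  independence : (l : List (Fin n × Form V n)) → Unique (map proj₁ l) →
                 All (λ (j , A) → ∃[ w ] w ⊨ [ j ] A) l → ∃[ g ] All (λ (j , A) → g ⊨ [ j ] A) l
  independence []            _           _              = replicate n false , []
  independence ((j , A) ∷ l) (j∉l ∷ uniq) ((w , wA) ∷ ws) =
    let g , gl = independence l uniq ws in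
    g [ j ]≔ lookup w j , stit-local (lookup∘update j g _) wA ∷ stit-update-others l j∉l gl

  soundness : ∀ {A} → ⊢ A → ∀ h → h ⊨ A
  soundness (taut t)     h = holds (t (sat h))
  soundness □K           h = ⇒-intro λ □A⇒B → ⇒-intro λ □A →
    □-intro λ g → ⇒-elim (□-elim □A⇒B g) (□-elim □A g)
  soundness □T           h = ⇒-intro λ □A → □-elim □A h
  soundness □5           h = ⇒-intro λ ◇A → □-intro λ _ → holds (truth ◇A)
  soundness stitK        h = ⇒-intro λ jA⇒B → ⇒-intro λ jA →
    stit-intro λ g e → ⇒-elim (stit-elim jA⇒B e) (stit-elim jA e)
  soundness stitT        h = ⇒-intro λ jA → stit-elim jA refl
  soundness stit5        h = ⇒-intro λ ¬j¬A → stit-intro λ g e →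
    ⇒-intro λ j¬A → ⊥'-elim (⇒-elim ¬j¬A (stit-local (sym e) j¬A))
  soundness □⇒stit       h = ⇒-intro λ □A → stit-intro λ g _ → □-elim □A g
  soundness (indep l uniq) h = ⇒-intro λ ◇s →
    let g , gl = independence l uniq (All.map ◇-elim (All.map⁻ (to (⋀-⊩ _) ◇s))) in
    ◇-intro g (from (⋀-⊩ _) (All.map⁺ gl))
  soundness (mp ⊢A⇒B ⊢A) h = ⇒-elim (soundness ⊢A⇒B h) (soundness ⊢A h)
  soundness (nec ⊢A)     h = □-intro (soundness ⊢A)

  sat-rTruth : ∀ r → (∀ x → ∃[ g ] val r g ≡ x) →
               (∀ j h x → ∃[ g ] lookup g j ≡ lookup h j × val r g ≡ x) →
               ∀ C → (∀ p → VarIn p C → p ≡ r) → ∀ h → sat h C ≡ rTruth C (val r h)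
  sat-rTruth r onto onto-cells = go
    where
    go : ∀ C → (∀ p → VarIn p C → p ≡ r) → ∀ h → sat h C ≡ rTruth C (val r h)
    go (var p)   only h = cong (λ q → val q h) (only p refl)
    go (A ⇒ B)   only h =
      cong₂ (λ a b → not a ∨ b) (go A (λ p → only p ∘ inj₁) h) (go B (λ p → only p ∘ inj₂) h)
    go ⊥'        only h = refl
    go (□ A)     only h = trans (allVec-cong λ g → go A only g) (allVec-∘-onto (rTruth A) (val r) onto)
    go ([ j ] A) only h =
      trans (allVec-cong λ g → go A only (g [ j ]≔ lookup h j)) (allVec-∘-onto (rTruth A) _ onto-cell)
      where
      onto-cell : ∀ x → ∃[ g ] val r (g [ j ]≔ lookup h j) ≡ x
      onto-cell x = let g , gj , rg = onto-cells j h x in g , trans (cong (val r) ([]≔-id-local g j gj)) rg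

module Counterexample (m : ℕ) where

  pattern p = Fin.zero
  pattern q = Fin.suc Fin.zero
  pattern r = Fin.suc (Fin.suc Fin.zero)

  N : ℕ
  N = suc (suc (suc (suc m)))

  a₀ a₁ a₂ a₃ : Fin N
  a₀ = # 0
  a₁ = # 1
  a₂ = # 2
  a₃ = # 3

  choices : List (Fin N × Form (Fin 3) N)
  choices = (a₀ , var p) ∷ (a₁ , var p ⇒ var r) ∷ (a₂ , var q) ∷ (a₃ , var q ⇒ ¬' (var r)) ∷ []

  choice-conjuncts A-conjuncts B-conjuncts : List (Form (Fin 3) N)
  choice-conjuncts = map (λ (j , X) → [ j ] X) choices
  A-conjuncts = ◇ ([ a₀ ] (var p)) ∷ ◇ ([ a₁ ] (var p ⇒ var r)) ∷ []
  B-conjuncts = ◇ ([ a₂ ] (var q)) ∷ ◇ ([ a₃ ] (var q ⇒ ¬' (var r))) ∷ []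

  joint-choice A B : Form (Fin 3) N
  joint-choice = ⋀ choice-conjuncts
  A = ⋀ A-conjuncts
  B = ¬' (⋀ B-conjuncts)

  ⊢¬joint-choice : ⊢ ¬' joint-choice
  ⊢¬joint-choice = ⇒-apply (⇒-apply ⊢⇒q⇒¬r ⊢⇒q) (⇒-apply ⊢⇒p⇒r ⊢⇒p)
    where
    conjunct : ∀ {j X} → [ j ] X ∈ choice-conjuncts → ⊢ (joint-choice ⇒ X)
    conjunct j∈ = ⇒-trans (⋀-elim choice-conjuncts j∈) stitT
    ⊢⇒p : ⊢ (joint-choice ⇒ var p)
    ⊢⇒p = conjunct (here refl)
    ⊢⇒p⇒r : ⊢ (joint-choice ⇒ (var p ⇒ var r))
    ⊢⇒p⇒r = conjunct (there (here refl))
    ⊢⇒q : ⊢ (joint-choice ⇒ var q)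
    ⊢⇒q = conjunct (there (there (here refl)))
    ⊢⇒q⇒¬r : ⊢ (joint-choice ⇒ (var q ⇒ ¬' (var r)))
    ⊢⇒q⇒¬r = conjunct (there (there (there (here refl))))

  ⊢A⇒B : ⊢ (A ⇒ B)
  ⊢A⇒B = ¬⋀-++⇒ A-conjuncts B-conjuncts
    (⇒-trans (indep choices distinct) (¬¬-intro (nec ⊢¬joint-choice)))
    where
    distinct : Unique (map proj₁ choices)
    distinct = ((λ ()) ∷ (λ ()) ∷ (λ ()) ∷ []) ∷ ((λ ()) ∷ (λ ()) ∷ []) ∷ ((λ ()) ∷ []) ∷ [] ∷ []

  shared-variables : ∀ x → VarIn x A → VarIn x B → x ≡ r
  shared-variables p _ inB = contradiction inB (toWitnessFalse {a? = varIn? _≟_ p B} _)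
  shared-variables q inA _ = contradiction inA (toWitnessFalse {a? = varIn? _≟_ q A} _)
  shared-variables r _ _   = refl

  val₁ val₂ : Fin 3 → Vec Bool N → Bool
  val₁ p h = lookup h a₀
  val₁ q h = false
  val₁ r h = lookup h a₀ xor lookup h a₁
  val₂ p h = false
  val₂ q h = lookup h a₂
  val₂ r h = lookup h a₂ xor lookup h a₃

  module M₁ = Semantics val₁
  module M₂ = Semantics val₂

  h₀ : Vec Bool N
  h₀ = replicate N false

  A-holds : h₀ M₁.⊨ A
  A-holds = from (⋀-⊩ _)
    ( M₁.◇-intro (replicate N true) (M₁.stit-intro λ g e → holds e)
    ∷ M₁.◇-intro h₀ (M₁.stit-intro λ g e → ⇒-intro λ gp → holds (cong₂ _xor_ (truth gp) e))
    ∷ [])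

  B-fails : ¬ (h₀ M₂.⊨ B)
  B-fails ¬choices = ⊥'-elim (⇒-elim ¬choices (from (⋀-⊩ _)
    ( M₂.◇-intro (replicate N true) (M₂.stit-intro λ g e → holds e)
    ∷ M₂.◇-intro (replicate N true) (M₂.stit-intro λ g e → ⇒-intro λ gq →
        holds (cong (λ b → not b ∨ false) (cong₂ _xor_ (truth gq) e)))
    ∷ [])))

  no-r-interpolant : ∀ C → (∀ x → VarIn x C → x ≡ r) → ⊢ (A ⇒ C) → ⊢ (C ⇒ B) → ⊥
  no-r-interpolant C r-only ⊢A⇒C ⊢C⇒B = B-fails (⇒-elim (M₂.soundness ⊢C⇒B h₀) C-holds₂)
    where
    open ≡-Reasoning
    C-holds₂ : h₀ M₂.⊨ C
    C-holds₂ = from M₂.⊨⇔sat (begin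
      M₂.sat h₀ C     ≡⟨ M₂.sat-rTruth r (xor-onto λ ()) (xor-onto-cells λ ()) C r-only h₀ ⟩
      rTruth C false  ≡⟨ sym (M₁.sat-rTruth r (xor-onto λ ()) (xor-onto-cells λ ()) C r-only h₀) ⟩
      M₁.sat h₀ C     ≡⟨ to M₁.⊨⇔sat (⇒-elim (M₁.soundness ⊢A⇒C h₀) A-holds) ⟩
      true            ∎)

  no-CIP : ¬ CIP N
  no-CIP cip with cip (Fin 3) A B ⊢A⇒B
  ... | C , vars , _ , ⊢A⇒C , ⊢C⇒B =
    no-r-interpolant C (λ x x∈C → uncurry (shared-variables x) (vars x x∈C)) ⊢A⇒C ⊢C⇒B

corollary3 : (n : ℕ) → 3 < n → ¬ CIP n
corollary3 (suc (suc (suc (suc m)))) (s≤s (s≤s (s≤s (s≤s z≤n)))) = Counterexample.no-CIP m
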